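{- Let $F^1,\dots,F^k\in\mathbb{R}_{\ge0}^n$ be $k$ frequency vectors (scenarios) over keys $\{1,\dots,n\}$, and let $L$ be the level vector produced by Algorithm R-bst described in the context. Then $L$ is a BST level vector and for every scenario $s\in\{1,\dots,k\}$, $$\mathrm{cost}(L,F^s)\le \lceil \log_2(k+1)\rceil\cdot \min_{L^*}\mathrm{cost}(L^*,F^s),$$ where the minimum ranges over all BST level vectors $L^*$ on $\{1,\dots,n\}$.
   Context: A vector $L\in\{1,\dots,n\}^n$ is a (BST) level vector if and only if for every $1\le i<j\le n$ with $L_i=L_j$ there is a key $r$ with $i<r<j$ and $L_r<L_i$ (these are the level vectors of binary search trees on keys $1,\dots,n$, root at level 1). $\mathrm{cost}(L,F)=\sum_i L_iF_i$. Algorithm R-bst: for each scenario $s$ compute a level vector $L^s$ minimizing $\mathrm{cost}(L^s,F^s)$. Then call the recursive procedure $A(1,n,1)$, where $A(i,j,\ell)$ does the following: if $i>j$, return. Otherwise let $v=\min\{L^s_r: i\le r\le j,\ 1\le s\le k\}$; let $S$ be the ordered set of keys $r\in[i,j]$ for which there is a scenario $s$ with $L^s_r=v$; choose $m\in S$ such that both $|S\cap[i,m-1]|$ and $|S\cap[m+1,j]|$ are at most $\lceil(|S|-1)/2\rceil$; set $L_m=\ell$; call $A(i,m-1,\ell+1)$ and $A(m+1,j,\ell+1)$.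
   Formalization: The frequency vectors $F^1,\dots,F^k$ have nonnegative rational entries instead of nonnegative real ones. -}

module Defs where

open import Data.Nat as ℕ using (ℕ; zero; suc; _∸_; _≤_; _<_; ⌈_/2⌉; _≡ᵇ_)
open import Data.Nat.Logarithm using (⌈log₂_⌉)
open import Data.Integer using (+_)
open import Data.Rational as ℚ using (ℚ; 0ℚ)
open import Data.Fin using (Fin)
open import Data.Bool using (Bool; true; false)
open import Data.List using (List; []; _∷_; allFin)
open import Data.Bool.ListAction using (any)
open import Data.Product using (Σ; _×_; ∃; ∃-syntax; _,_)
open import Relation.Binary.PropositionalEquality using (_≡_)
open import Relation.Nullary.Decidable using (does)
open import Relation.Unary using (Pred)

-- Keys are the natural numbers 1..n; a vector over the keys is a
-- function ℕ → A of which only the values at 1..n matter.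

rangeFrom : ℕ → ℕ → List ℕ
rangeFrom a zero = []
rangeFrom a (suc len) = a ∷ rangeFrom (suc a) len

keys : ℕ → ℕ → List ℕ
keys a b = rangeFrom a (suc b ∸ a)

costFrom : (ℕ → ℕ) → (ℕ → ℚ) → List ℕ → ℚ
costFrom L F [] = 0ℚ
costFrom L F (i ∷ is) = ((+ L i) ℚ./ 1) ℚ.* F i ℚ.+ costFrom L F is

cost : ℕ → (ℕ → ℕ) → (ℕ → ℚ) → ℚ
cost n L F = costFrom L F (keys 1 n)

IsLevelVector : ℕ → (ℕ → ℕ) → Set
IsLevelVector n L =
  (∀ i → 1 ≤ i → i ≤ n → 1 ≤ L i × L i ≤ n) ×
  (∀ i j → 1 ≤ i → i < j → j ≤ n → L i ≡ L j →
     ∃[ r ] (i < r × r < j × L r < L i))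

IsOptimal : ℕ → (ℕ → ℚ) → (ℕ → ℕ) → Set
IsOptimal n F L =
  IsLevelVector n L × (∀ L′ → IsLevelVector n L′ → cost n L F ℚ.≤ cost n L′ F)

module RBST {k : ℕ} (Ls : Fin k → ℕ → ℕ) where

  inS : ℕ → ℕ → Bool
  inS v r = any (λ s → Ls s r ≡ᵇ v) (allFin k)

  countS : ℕ → ℕ → ℕ → ℕ
  countS v a b = countList (keys a b)
    where
    countList : List ℕ → ℕ
    countList [] = 0
    countList (r ∷ rs) with inS v r
    ... | true = suc (countList rs)
    ... | false = countList rs

  IsMinLevel : ℕ → ℕ → ℕ → Set
  IsMinLevel i j v =
    (∃[ r ] ∃[ s ] (i ≤ r × r ≤ j × Ls s r ≡ v)) ×
    (∀ r s → i ≤ r → r ≤ j → v ≤ Ls s r)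

  -- Runs i j ℓ L : L restricted to keys i..j is a possible result of the
  -- call A(i,j,ℓ) (over all admissible choices of the median m).
  data Runs : ℕ → ℕ → ℕ → (ℕ → ℕ) → Set where
    done : ∀ {i j ℓ L} → j < i → Runs i j ℓ L
    step : ∀ {i j ℓ L} (v m : ℕ) →
      i ≤ j →
      IsMinLevel i j v →
      i ≤ m → m ≤ j →
      inS v m ≡ true →
      countS v i (m ∸ 1) ≤ ⌈ (countS v i j ∸ 1) /2⌉ →
      countS v (suc m) j ≤ ⌈ (countS v i j ∸ 1) /2⌉ →
      L m ≡ ℓ →
      Runs i (m ∸ 1) (suc ℓ) L →
      Runs (suc m) j (suc ℓ) L →
      Runs i j ℓ L

  Output : ℕ → (ℕ → ℕ) → Set
  Output n L = Runs 1 n 1 L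

{-# OPTIONS --safe #-}
module Submission where

-- Fix a scenario s and put c = ⌈log₂(k+1)⌉. To a call A(i,j,ℓ) with minimum
-- level v, whose set S ∩ [i,j] has t elements, attach the potential
-- c·v − ⌈log₂(t+1)⌉. It grows by at least one from a call to each of its
-- recursive calls: either the minimum level stays v and the median choice
-- halves t, or the minimum level grows while the subtracted term stays ≤ c,
-- because t ≤ k (a scenario has at most one key at the minimum level of a
-- range: two such keys would enclose a key of smaller level). The potential of
-- the first call is ≥ 0, and a key r placed at level ℓ is the median of a call
-- of potential < c·v ≤ c·L^s_r; hence L_r ≤ c·L^s_r. Weighting by F^s_r ≥ 0,
-- summing, and using the optimality of L^s gives the bound.

open import Defs
open import Data.Bool using (Bool; true; false; _∨_; if_then_else_)
open import Data.Bool.Properties using (T-≡; ¬-not)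
open import Data.Bool.ListAction using (any)
open import Data.Empty using (⊥)
open import Data.Fin using (Fin)
open import Data.Integer using (+_)
import Data.Integer as ℤ
import Data.Integer.Properties as ℤ
open import Data.List using (List; []; _∷_; length; allFin)
open import Data.List.Membership.Propositional using (_∈_)
open import Data.List.Properties using (length-tabulate)
open import Data.List.Relation.Unary.Any using (here; there)
open import Data.Nat using (ℕ; zero; suc; _+_; _*_; _∸_; _≤_; _<_; z≤n; s≤s; ⌈_/2⌉; _≡ᵇ_; >-nonZero)
open import Data.Nat.Properties
open import Data.Nat.Logarithm using (⌈log₂_⌉; ⌈log₂⌉-mono-≤; ⌈log₂⌈n/2⌉⌉≡⌈log₂n⌉∸1)
open import Data.Nat.Tactic.RingSolver using (solve)
import Data.Nat.Coprimality as Coprime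
open import Data.Product using (∃; ∃-syntax; _×_; _,_; proj₁; proj₂; uncurry)
open import Data.Rational as ℚ using (ℚ; 0ℚ; mkℚ; _/_)
import Data.Rational.Properties as ℚ
open import Data.Sum using (inj₁; inj₂)
open import Function using (id; _∘_; Equivalence)
open import Relation.Binary.Definitions using (tri<; tri≈; tri>)
open import Relation.Binary.PropositionalEquality
open import Relation.Nullary using (contradiction)

private
  variable
    A B : Set
    a b i j r v v′ ℓ : ℕ

count : (A → Bool) → List A → ℕ
count p []       = 0
count p (x ∷ xs) = if p x then suc (count p xs) else count p xs

∈⇒0<count : ∀ {p : A → Bool} {x xs} → x ∈ xs → p x ≡ true → 0 < count p xs
∈⇒0<count (here refl) px rewrite px = s≤s z≤n
∈⇒0<count {p = p} (there {x = y} x∈xs) px with p y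
... | true  = s≤s z≤n
... | false = ∈⇒0<count x∈xs px

count≡0 : ∀ {p : A → Bool} {xs} → (∀ {x} → x ∈ xs → p x ≡ false) → count p xs ≡ 0
count≡0 {xs = []}     _      = refl
count≡0 {xs = x ∷ xs} never rewrite never (here refl) = count≡0 (λ x∈xs → never (there x∈xs))

count-∨ : ∀ {p q : A → Bool} xs → count (λ x → p x ∨ q x) xs ≤ count p xs + count q xs
count-∨ [] = z≤n
count-∨ {p = p} {q} (x ∷ xs) with p x | q x
... | true  | true  = s≤s (≤-trans (count-∨ xs) (+-monoʳ-≤ (count p xs) (n≤1+n (count q xs))))
... | true  | false = s≤s (count-∨ xs)
... | false | true  = ≤-trans (s≤s (count-∨ xs)) (≤-reflexive (sym (+-suc (count p xs) (count q xs))))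
... | false | false = count-∨ xs

count-any≤length : ∀ {Q : B → A → Bool} ss xs → (∀ s → count (Q s) xs ≤ 1) →
                   count (λ x → any (λ s → Q s x) ss) xs ≤ length ss
count-any≤length []       xs _       = ≤-reflexive (count≡0 {xs = xs} (λ _ → refl))
count-any≤length (s ∷ ss) xs at-most =
  ≤-trans (count-∨ xs) (+-mono-≤ (at-most s) (count-any≤length ss xs at-most))

∈-rangeFrom⁻ : ∀ a len → r ∈ rangeFrom a len → a ≤ r × r < a + len
∈-rangeFrom⁻ a (suc len) (here refl) = ≤-refl , m<m+n a (s≤s z≤n)
∈-rangeFrom⁻ {r} a (suc len) (there r∈) with ∈-rangeFrom⁻ (suc a) len r∈
... | a<r , r<end = <⇒≤ a<r , subst (r <_) (sym (+-suc a len)) r<end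

∈-rangeFrom⁺ : ∀ a len → a ≤ r → r < a + len → r ∈ rangeFrom a len
∈-rangeFrom⁺ a zero      a≤r r<a+0 = contradiction (subst (_ <_) (+-identityʳ a) r<a+0) (≤⇒≯ a≤r)
∈-rangeFrom⁺ {r} a (suc len) a≤r r<end with m≤n⇒m<n∨m≡n a≤r
... | inj₁ a<r  = there (∈-rangeFrom⁺ (suc a) len a<r (subst (r <_) (+-suc a len) r<end))
... | inj₂ refl = here refl

count-rangeFrom≤1 : ∀ {p : ℕ → Bool} a len →
  (∀ {x y} → x ∈ rangeFrom a len → y ∈ rangeFrom a len → x < y → p x ≡ true → p y ≡ true → ⊥) →
  count p (rangeFrom a len) ≤ 1
count-rangeFrom≤1 a zero _ = z≤n
count-rangeFrom≤1 {p} a (suc len) not-two with p a in pa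
... | true  = ≤-reflexive (cong suc (count≡0 λ y∈ →
                ¬-not (not-two (here refl) (there y∈) (proj₁ (∈-rangeFrom⁻ (suc a) len y∈)) pa)))
... | false = count-rangeFrom≤1 (suc a) len (λ x∈ y∈ → not-two (there x∈) (there y∈))

∈-keys⁺ : a ≤ r → r ≤ b → r ∈ keys a b
∈-keys⁺ {a} {r} {b} a≤r r≤b =
  ∈-rangeFrom⁺ a (suc b ∸ a) a≤r (subst (r <_) (sym (m+[n∸m]≡n (≤-trans a≤r (m≤n⇒m≤1+n r≤b)))) (s≤s r≤b))

∈-keys⁻ : r ∈ keys a b → a ≤ r × r ≤ b
∈-keys⁻ {r} {a} {b} r∈ with ∈-rangeFrom⁻ a (suc b ∸ a) r∈ | ≤-total a (suc b)
... | a≤r , r<end | inj₁ a≤1+b = a≤r , ≤-pred (subst (r <_) (m+[n∸m]≡n a≤1+b) r<end)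
... | a≤r , r<end | inj₂ 1+b≤a =
  contradiction (subst (r <_) (trans (cong (_+_ a) (m≤n⇒m∸n≡0 1+b≤a)) (+-identityʳ a)) r<end) (≤⇒≯ a≤r)

suc∸-injective : ∀ a b {len} → suc b ∸ a ≡ suc len → b ∸ a ≡ len
suc∸-injective zero          b       eq = suc-injective eq
suc∸-injective (suc a)       (suc b) eq = suc∸-injective a b eq
suc∸-injective (suc zero)    zero    ()
suc∸-injective (suc (suc a)) zero    ()

balancedHeight : ℕ → ℕ
balancedHeight t = ⌈log₂ suc t ⌉

balancedHeight-mono-≤ : ∀ {t t′} → t ≤ t′ → balancedHeight t ≤ balancedHeight t′
balancedHeight-mono-≤ t≤t′ = ⌈log₂⌉-mono-≤ (s≤s t≤t′)

0<balancedHeight : ∀ {t} → 0 < t → 0 < balancedHeight t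
0<balancedHeight = balancedHeight-mono-≤ {1}

balancedHeight-half : ∀ t {t′} → t′ ≤ ⌈ t /2⌉ → suc (balancedHeight t′) ≤ balancedHeight (suc t)
balancedHeight-half t {t′} t′≤half = begin
  suc (balancedHeight t′)               ≤⟨ s≤s (balancedHeight-mono-≤ t′≤half) ⟩
  suc ⌈log₂ ⌈ suc (suc t) /2⌉ ⌉         ≡⟨ cong suc (⌈log₂⌈n/2⌉⌉≡⌈log₂n⌉∸1 (suc (suc t))) ⟩
  suc (balancedHeight (suc t) ∸ 1)      ≡⟨ m+[n∸m]≡n (0<balancedHeight {suc t} (s≤s z≤n)) ⟩
  balancedHeight (suc t)                ∎
  where open ≤-Reasoning

-- The potential c·v − balancedHeight t of a call increases strictly towards a
-- recursive call; stated with both sides moved so that no subtraction occurs.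
potential-increases : ∀ c {v v′ t t′} → v ≤ v′ → 0 < t → (v′ ≡ v → t′ ≤ ⌈ (t ∸ 1) /2⌉) →
  balancedHeight t′ ≤ c → c * v + balancedHeight t′ < c * v′ + balancedHeight t
potential-increases c {v} {v′} {suc t} {t′} v≤v′ _ halves t′-bounded with m≤n⇒m<n∨m≡n v≤v′
... | inj₂ refl = +-monoʳ-< (c * v′) (balancedHeight-half t (halves refl))
... | inj₁ v<v′ = begin-strict
  c * v + balancedHeight t′              ≤⟨ +-monoʳ-≤ (c * v) t′-bounded ⟩
  c * v + c                              ≡⟨ trans (+-comm (c * v) c) (sym (*-suc c v)) ⟩
  c * suc v                              ≤⟨ *-monoʳ-≤ c v<v′ ⟩
  c * v′                                 <⟨ m<m+n (c * v′) (0<balancedHeight {suc t} (s≤s z≤n)) ⟩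
  c * v′ + balancedHeight (suc t)        ∎
  where open ≤-Reasoning

<-+-chain : ∀ {x y a b a′ b′} → x + a′ < suc y + b′ → a + b′ < a′ + b → x + a < y + b
<-+-chain {x} {y} {a} {b} {a′} {b′} p q = +-cancelʳ-< (a′ + b′) (x + a) (y + b) (≤-pred (begin
  suc (suc (x + a + (a′ + b′))) ≡⟨ solve (x ∷ a ∷ a′ ∷ b′ ∷ []) ⟩
  suc (x + a′) + suc (a + b′)   ≤⟨ +-mono-≤ p q ⟩
  suc y + b′ + (a′ + b)         ≡⟨ solve (y ∷ b ∷ a′ ∷ b′ ∷ []) ⟩
  suc (y + b + (a′ + b′))       ∎))
  where open ≤-Reasoning

ι : ℕ → ℚ
ι m = + m / 1

ι≡mkℚ : ∀ m → ι m ≡ mkℚ (+ m) 0 (Coprime.sym (Coprime.1-coprimeTo m))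
ι≡mkℚ m = ℚ.normalize-coprime (Coprime.sym (Coprime.1-coprimeTo m))

ι-mono-≤ : ∀ {m n} → m ≤ n → ι m ℚ.≤ ι n
ι-mono-≤ {m} {n} m≤n rewrite ι≡mkℚ m | ι≡mkℚ n =
  ℚ.*≤* (subst₂ ℤ._≤_ (sym (ℤ.*-identityʳ (+ m))) (sym (ℤ.*-identityʳ (+ n))) (ℤ.+≤+ m≤n))

ι-homo-* : ∀ m n → ι m ℚ.* ι n ≡ ι (m * n)
ι-homo-* m n rewrite ι≡mkℚ m | ι≡mkℚ n = cong (_/ 1) (sym (ℤ.pos-* m n))

costFrom-≤-* : ∀ {L L′ : ℕ → ℕ} {F : ℕ → ℚ} c xs →
  (∀ {r} → r ∈ xs → L r ≤ c * L′ r) → (∀ {r} → r ∈ xs → 0ℚ ℚ.≤ F r) →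
  costFrom L F xs ℚ.≤ ι c ℚ.* costFrom L′ F xs
costFrom-≤-* c [] _ _ = ℚ.≤-reflexive (sym (ℚ.*-zeroʳ (ι c)))
costFrom-≤-* {L} {L′} {F} c (r ∷ rs) L≤cL′ F≥0 = begin
  ι (L r) ℚ.* F r ℚ.+ costFrom L F rs
    ≤⟨ ℚ.+-mono-≤ head-≤ (costFrom-≤-* c rs (λ r∈ → L≤cL′ (there r∈)) (λ r∈ → F≥0 (there r∈))) ⟩
  ι c ℚ.* (ι (L′ r) ℚ.* F r) ℚ.+ ι c ℚ.* costFrom L′ F rs
    ≡⟨ sym (ℚ.*-distribˡ-+ (ι c) (ι (L′ r) ℚ.* F r) (costFrom L′ F rs)) ⟩
  ι c ℚ.* costFrom L′ F (r ∷ rs) ∎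
  where
  open ℚ.≤-Reasoning
  head-≤ : ι (L r) ℚ.* F r ℚ.≤ ι c ℚ.* (ι (L′ r) ℚ.* F r)
  head-≤ = begin
    ι (L r) ℚ.* F r
      ≤⟨ ℚ.*-monoʳ-≤-nonNeg (F r) {{ℚ.nonNegative (F≥0 (here refl))}} (ι-mono-≤ (L≤cL′ (here refl))) ⟩
    ι (c * L′ r) ℚ.* F r     ≡⟨ cong (ℚ._* F r) (sym (ι-homo-* c (L′ r))) ⟩
    ι c ℚ.* ι (L′ r) ℚ.* F r ≡⟨ ℚ.*-assoc (ι c) (ι (L′ r)) (F r) ⟩
    ι c ℚ.* (ι (L′ r) ℚ.* F r) ∎

module _ {k : ℕ} (Ls : Fin k → ℕ → ℕ) where
  open RBST Ls

  -- countS is defined through a local function of Defs, so it is unfolded one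
  -- key at a time by abstracting over the length suc b ∸ a of keys a b.
  countS≡count : ∀ v a b → countS v a b ≡ count (inS v) (keys a b)
  countS≡count v a b = go a (suc b ∸ a) refl
    where
    go : ∀ a len → suc b ∸ a ≡ len → countS v a b ≡ count (inS v) (rangeFrom a len)
    go a zero eq with suc b ∸ a | eq
    ... | .0 | refl = refl
    go a (suc len) eq with go (suc a) len (suc∸-injective a b eq)
    ... | rest with suc b ∸ a | eq | b ∸ a | suc∸-injective a b eq
    ... | .(suc len) | refl | .len | refl with inS v a
    ... | true  = cong suc rest
    ... | false = rest

  0<countS : ∀ {m} → inS v m ≡ true → a ≤ m → m ≤ b → 0 < countS v a b
  0<countS {v} {a} {b} m∈S a≤m m≤b rewrite countS≡count v a b = ∈⇒0<count (∈-keys⁺ a≤m m≤b) m∈S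

  IsMinLevel-subrange-≤ : ∀ {i′ j′} → i ≤ i′ → j′ ≤ j → IsMinLevel i j v → IsMinLevel i′ j′ v′ → v ≤ v′
  IsMinLevel-subrange-≤ {v = v} i≤i′ j′≤j (_ , v≤) ((r , s , i′≤r , r≤j′ , Lr≡v′) , _) =
    subst (v ≤_) Lr≡v′ (v≤ r s (≤-trans i≤i′ i′≤r) (≤-trans r≤j′ j′≤j))

  IsMinLevel-unique : IsMinLevel i j v → IsMinLevel i j v′ → v ≡ v′
  IsMinLevel-unique min min′ = ≤-antisym (IsMinLevel-subrange-≤ ≤-refl ≤-refl min min′)
                                         (IsMinLevel-subrange-≤ ≤-refl ≤-refl min′ min)

  Runs-min : ∀ {L} → Runs i j ℓ L → i ≤ r → r ≤ j → ∃ (IsMinLevel i j)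
  Runs-min (done j<i) i≤r r≤j = contradiction (≤-trans i≤r r≤j) (<⇒≱ j<i)
  Runs-min (step v _ _ min _ _ _ _ _ _ _ _) _ _ = v , min

  Runs-≥ : ∀ {L} → Runs i j ℓ L → i ≤ r → r ≤ j → ℓ ≤ L r
  Runs-≥ (done j<i) i≤r r≤j = contradiction (≤-trans i≤r r≤j) (<⇒≱ j<i)
  Runs-≥ {r = r} (step _ m _ _ _ _ _ _ _ Lm≡ℓ left right) i≤r r≤j with <-cmp r m
  ... | tri< (s≤s r≤m′) _ _ = ≤-trans (n≤1+n _) (Runs-≥ left i≤r r≤m′)
  ... | tri≈ _ refl _       = ≤-reflexive (sym Lm≡ℓ)
  ... | tri> _ _ m<r        = ≤-trans (n≤1+n _) (Runs-≥ right m<r r≤j)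

  Runs-≤ : ∀ {L} → Runs i j ℓ L → i ≤ r → r ≤ j → L r + i ≤ ℓ + j
  Runs-≤ (done j<i) i≤r r≤j = contradiction (≤-trans i≤r r≤j) (<⇒≱ j<i)
  Runs-≤ {i} {j} {ℓ} {r} {L} (step _ m i≤j _ i≤m m≤j _ _ _ Lm≡ℓ left right) i≤r r≤j with <-cmp r m
  ... | tri< (s≤s {n = m′} r≤m′) _ _ =
    ≤-trans (Runs-≤ left i≤r r≤m′) (≤-trans (≤-reflexive (sym (+-suc ℓ m′))) (+-monoʳ-≤ ℓ m≤j))
  ... | tri≈ _ refl _ = subst (λ l → l + i ≤ ℓ + j) (sym Lm≡ℓ) (+-monoʳ-≤ ℓ i≤j)
  ... | tri> _ _ m<r  =
    ≤-trans (+-monoʳ-≤ (L r) i≤m)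
            (≤-pred (≤-trans (≤-reflexive (sym (+-suc (L r) m))) (Runs-≤ right m<r r≤j)))

  Runs-separated : ∀ {L x y} → Runs i j ℓ L → i ≤ x → x < y → y ≤ j → L x ≡ L y →
                   ∃[ r ] (x < r × r < y × L r < L x)
  Runs-separated (done j<i) i≤x x<y y≤j _ = contradiction (≤-trans i≤x (≤-trans (<⇒≤ x<y) y≤j)) (<⇒≱ j<i)
  Runs-separated {ℓ = ℓ} {L} {x} {y} (step _ m _ _ _ _ _ _ _ Lm≡ℓ left right) i≤x x<y y≤j Lx≡Ly
    with <-cmp x m | <-cmp y m
  ... | tri< (s≤s x≤m′) _ _ | tri< (s≤s y≤m′) _ _ = Runs-separated left i≤x x<y y≤m′ Lx≡Ly
  ... | tri< (s≤s x≤m′) _ _ | tri≈ _ refl _ =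
    contradiction (subst (ℓ <_) (trans Lx≡Ly Lm≡ℓ) (Runs-≥ left i≤x x≤m′)) (<-irrefl refl)
  ... | tri< x<m@(s≤s x≤m′) _ _ | tri> _ _ m<y =
    m , x<m , m<y , subst (_< L x) (sym Lm≡ℓ) (Runs-≥ left i≤x x≤m′)
  ... | tri≈ _ refl _ | _ =
    contradiction (subst (ℓ <_) (trans (sym Lx≡Ly) Lm≡ℓ) (Runs-≥ right x<y y≤j)) (<-irrefl refl)
  ... | tri> _ _ m<x | _ = Runs-separated right m<x x<y y≤j Lx≡Ly

  Output⇒IsLevelVector : ∀ {n L} → Output n L → IsLevelVector n L
  Output⇒IsLevelVector {n} {L} R =
    (λ r 1≤r r≤n → Runs-≥ R 1≤r r≤n , ≤-pred (subst (_≤ suc n) (+-comm (L r) 1) (Runs-≤ R 1≤r r≤n))) ,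
    (λ x y 1≤x x<y y≤n → Runs-separated R 1≤x x<y y≤n)

  module Approximation {n : ℕ} (level-vectors : ∀ s → IsLevelVector n (Ls s)) where

    countS≤k : 1 ≤ a → b ≤ n → (∀ r s → a ≤ r → r ≤ b → v ≤ Ls s r) → countS v a b ≤ k
    countS≤k {a} {b} {v} 1≤a b≤n v≤ = begin
      countS v a b              ≡⟨ countS≡count v a b ⟩
      count (inS v) (keys a b)  ≤⟨ count-any≤length (allFin k) (keys a b) at-most-one ⟩
      length (allFin k)         ≡⟨ length-tabulate id ⟩
      k                         ∎
      where
      open ≤-Reasoning
      at-level : ∀ {s r} → (Ls s r ≡ᵇ v) ≡ true → Ls s r ≡ v
      at-level e = ≡ᵇ⇒≡ _ _ (Equivalence.from T-≡ e)
      at-most-one : ∀ s → count (λ r → Ls s r ≡ᵇ v) (keys a b) ≤ 1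
      at-most-one s = count-rangeFrom≤1 a (suc b ∸ a) not-two
        where
        not-two : ∀ {x y} → x ∈ keys a b → y ∈ keys a b → x < y →
                  (Ls s x ≡ᵇ v) ≡ true → (Ls s y ≡ᵇ v) ≡ true → ⊥
        not-two {x} {y} x∈ y∈ x<y x-at-v y-at-v
          with ∈-keys⁻ x∈ | ∈-keys⁻ y∈
        ... | a≤x , _ | _ , y≤b
          with proj₂ (level-vectors s) x y (≤-trans 1≤a a≤x) x<y (≤-trans y≤b b≤n)
                     (trans (at-level x-at-v) (sym (at-level y-at-v)))
        ... | r , x<r , r<y , Lr<Lx =
          <⇒≱ (subst (Ls s r <_) (at-level x-at-v) Lr<Lx)
              (v≤ r s (≤-trans a≤x (<⇒≤ x<r)) (≤-trans (<⇒≤ r<y) y≤b))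

    0<IsMinLevel : 1 ≤ i → j ≤ n → IsMinLevel i j v → 0 < v
    0<IsMinLevel 1≤i j≤n ((r , s , i≤r , r≤j , Lr≡v) , _) =
      subst (0 <_) Lr≡v (proj₁ (proj₁ (level-vectors s) r (≤-trans 1≤i i≤r) (≤-trans r≤j j≤n)))

    ratio : ℕ
    ratio = balancedHeight k

    depth-invariant-from-child : ∀ s {i j i′ j′ ℓ v r} {L : ℕ → ℕ} →
      Runs i′ j′ (suc ℓ) L → i′ ≤ r → r ≤ j′ → 1 ≤ i → j ≤ n → i ≤ i′ → j′ ≤ j →
      IsMinLevel i j v → 0 < countS v i j → countS v i′ j′ ≤ ⌈ (countS v i j ∸ 1) /2⌉ →
      (∀ {v′} → IsMinLevel i′ j′ v′ →
        L r + ratio * v′ < suc ℓ + ratio * Ls s r + balancedHeight (countS v′ i′ j′)) →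
      L r + ratio * v < ℓ + ratio * Ls s r + balancedHeight (countS v i j)
    depth-invariant-from-child s {i′ = i′} {j′} {ℓ} {r = r} {L}
      R′ i′≤r r≤j′ 1≤i j≤n i≤i′ j′≤j min 0<t halves child-bound with Runs-min R′ i′≤r r≤j′
    ... | v′ , min′ = <-+-chain {x = L r} {y = ℓ + ratio * Ls s r} (child-bound min′)
      (potential-increases ratio {t′ = countS v′ i′ j′} (IsMinLevel-subrange-≤ i≤i′ j′≤j min min′) 0<t
        (λ { refl → halves }) (balancedHeight-mono-≤ t′≤k))
      where
      t′≤k : countS v′ i′ j′ ≤ k
      t′≤k = countS≤k (≤-trans 1≤i i≤i′) (≤-trans j′≤j j≤n) (proj₂ min′)

    depth-invariant : ∀ s {L} → Runs i j ℓ L → 1 ≤ i → j ≤ n → IsMinLevel i j v → i ≤ r → r ≤ j →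
      L r + ratio * v < ℓ + ratio * Ls s r + balancedHeight (countS v i j)
    depth-invariant s (done j<i) _ _ _ i≤r r≤j = contradiction (≤-trans i≤r r≤j) (<⇒≱ j<i)
    depth-invariant {i} {j} {ℓ} {v} {r} s {L}
      (step _ m _ min₀ i≤m m≤j m∈S left-halves right-halves Lm≡ℓ left right) 1≤i j≤n min i≤r r≤j
      with IsMinLevel-unique min₀ min | <-cmp r m | 0<countS m∈S i≤m m≤j
    ... | refl | tri< (s≤s r≤m′) _ _ | 0<t =
      depth-invariant-from-child s left i≤r r≤m′ 1≤i j≤n ≤-refl (<⇒≤ m≤j) min 0<t left-halves
        (λ min′ → depth-invariant s left 1≤i (≤-trans (<⇒≤ m≤j) j≤n) min′ i≤r r≤m′)
    ... | refl | tri> _ _ m<r | 0<t =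
      depth-invariant-from-child s right m<r r≤j 1≤i j≤n (≤-trans i≤m (n≤1+n m)) ≤-refl min 0<t right-halves
        (λ min′ → depth-invariant s right (s≤s z≤n) j≤n min′ m<r r≤j)
    ... | refl | tri≈ _ refl _ | 0<t = begin-strict
      L m + ratio * v                                    ≡⟨ cong (_+ ratio * v) Lm≡ℓ ⟩
      ℓ + ratio * v                                      ≤⟨ +-monoʳ-≤ ℓ (*-monoʳ-≤ ratio (proj₂ min m s i≤m m≤j)) ⟩
      ℓ + ratio * Ls s m                                 <⟨ m<m+n _ (0<balancedHeight 0<t) ⟩
      ℓ + ratio * Ls s m + balancedHeight (countS v i j) ∎
      where open ≤-Reasoning

    Output⇒L≤ratio*Ls : ∀ {L} → Output n L → ∀ s → 1 ≤ r → r ≤ n → L r ≤ ratio * Ls s r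
    Output⇒L≤ratio*Ls {r} {L} R s 1≤r r≤n with Runs-min R 1≤r r≤n
    ... | v , min = +-cancelʳ-≤ (ratio * v) (L r) (ratio * Ls s r) (begin
      L r + ratio * v                                  ≤⟨ ≤-pred (depth-invariant s R ≤-refl ≤-refl min 1≤r r≤n) ⟩
      ratio * Ls s r + balancedHeight (countS v 1 n)   ≤⟨ +-monoʳ-≤ (ratio * Ls s r) t-bounded ⟩
      ratio * Ls s r + ratio * v                       ∎)
      where
      open ≤-Reasoning
      t-bounded : balancedHeight (countS v 1 n) ≤ ratio * v
      t-bounded = ≤-trans (balancedHeight-mono-≤ (countS≤k ≤-refl ≤-refl (proj₂ min)))
                          (m≤m*n ratio v {{>-nonZero (0<IsMinLevel ≤-refl ≤-refl min)}})

theorem2 : (n k : ℕ) → 1 ≤ k →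
    (F : Fin k → ℕ → ℚ) →
    (∀ s r → 1 ≤ r → r ≤ n → 0ℚ ℚ.≤ F s r) →
    (Ls : Fin k → ℕ → ℕ) →
    (∀ s → IsOptimal n (F s) (Ls s)) →
    (L : ℕ → ℕ) → RBST.Output Ls n L →
    IsLevelVector n L ×
    (∀ s L* → IsLevelVector n L* →
      cost n L (F s) ℚ.≤ ((+ ⌈log₂ (suc k) ⌉) ℚ./ 1) ℚ.* cost n L* (F s))
theorem2 n k _ F F≥0 Ls optimal L output = Output⇒IsLevelVector Ls output , bound
  where
  open Approximation Ls (proj₁ ∘ optimal)
  bound : ∀ s L* → IsLevelVector n L* → cost n L (F s) ℚ.≤ ι ratio ℚ.* cost n L* (F s)
  bound s L* L*-valid = begin
    cost n L (F s)
      ≤⟨ costFrom-≤-* ratio (keys 1 n) (λ r∈ → uncurry (Output⇒L≤ratio*Ls output s) (∈-keys⁻ r∈))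
                                       (λ r∈ → uncurry (F≥0 s _) (∈-keys⁻ r∈)) ⟩
    ι ratio ℚ.* cost n (Ls s) (F s)
      ≤⟨ ℚ.*-monoˡ-≤-nonNeg (ι ratio) {{ℚ.normalize-nonNeg ratio 1}} (proj₂ (optimal s) L* L*-valid) ⟩
    ι ratio ℚ.* cost n L* (F s) ∎
    where open ℚ.≤-Reasoning
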